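{- Let $G=(V,E)$ be a weakly connected oriented graph such that (P1) every vertex has in-degree $2$ and out-degree $2$, and (P2) the two in-neighbors of every vertex are adjacent. Then $|V|\ge5$ and $G$ is isomorphic to $F_{|V|}$, where for $n\in\mathbb N$ the digraph $F_n$ has vertex set $\{0,1,\dots,n-1\}$ and arc set $\{(i,(i+1)\bmod n): 0\le i\le n-1\}\cup\{(i,(i+2)\bmod n):0\le i\le n-1\}$.
   Context: An oriented graph is a digraph with no 2-cycles and no self-loops. Two vertices are adjacent if there is an arc between them in either direction. -}

module Defs where

open import Data.Nat using (ℕ; zero; suc; _+_; _%_)
open import Data.Nat.Properties using (_≟_)
open import Data.Fin using (Fin; toℕ)
open import Data.Bool using (Bool; true; false; _∨_)
open import Data.List using (List; length; filter; allFin)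
open import Data.Sum using (_⊎_)
open import Data.Product using (_×_)
open import Relation.Binary.PropositionalEquality using (_≡_; _≢_)
open import Relation.Nullary.Decidable using (⌊_⌋)
open import Data.Bool.Properties using () renaming (_≟_ to _≟ᵇ_)

Digraph : ℕ → Set
Digraph n = Fin n → Fin n → Bool

Oriented : ∀ {n} → Digraph n → Set
Oriented {n} A = ((u : Fin n) → A u u ≡ false)
               × ((u v : Fin n) → A u v ≡ true → A v u ≡ false)

outDeg : ∀ {n} → Digraph n → Fin n → ℕ
outDeg {n} A u = length (filter (λ v → A u v ≟ᵇ true) (allFin n))

inDeg : ∀ {n} → Digraph n → Fin n → ℕ
inDeg {n} A v = length (filter (λ u → A u v ≟ᵇ true) (allFin n))

Adjacent : ∀ {n} → Digraph n → Fin n → Fin n → Set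
Adjacent A u v = (A u v ≡ true) ⊎ (A v u ≡ true)

data WeakReach {n : ℕ} (A : Digraph n) (u : Fin n) : Fin n → Set where
  here : WeakReach A u u
  step : ∀ {v w} → WeakReach A u v → Adjacent A v w → WeakReach A u w

data NonEmpty : ℕ → Set where
  nonEmpty : ∀ m → NonEmpty (suc m)

WeaklyConnected : ∀ {n} → Digraph n → Set
WeaklyConnected {n} A = NonEmpty n × ((u v : Fin n) → WeakReach A u v)

P1 : ∀ {n} → Digraph n → Set
P1 {n} A = (v : Fin n) → (inDeg A v ≡ 2) × (outDeg A v ≡ 2)

P2 : ∀ {n} → Digraph n → Set
P2 {n} A = (v u w : Fin n) → A u v ≡ true → A w v ≡ true → u ≢ w → Adjacent A u w

F : (n : ℕ) → Digraph n
F zero    () j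
F (suc m) i j = ⌊ toℕ j ≟ (toℕ i + 1) % suc m ⌋ ∨ ⌊ toℕ j ≟ (toℕ i + 2) % suc m ⌋

-- Orient the two in-neighbours of each vertex v as bottom v ⟶ top v (they are adjacent by P2).
-- Then top (top v) = bottom v, since otherwise bottom v would have three out-neighbours, and
-- top is injective; its inverse succ is a permutation whose arcs are exactly u ⟶ succ u and
-- u ⟶ succ (succ u). Weak connectivity makes every vertex lie on the succ-orbit of one vertex,
-- so succ is a single n-cycle and numbering the vertices along it gives an isomorphism with F n.
-- Orientedness rules out cycles of succ of length at most 4.
module Submission where

open import Defs
open import Data.Nat using (ℕ; _≤_)
open import Data.Fin using (Fin)
open import Data.Product using (_×_; Σ)
open import Function.Bundles using (_⤖_; Bijection)
open import Relation.Binary.PropositionalEquality using (_≡_)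

open import Data.Bool using (Bool; true; false; _∨_)
open import Data.Bool.Properties using () renaming (_≟_ to _≟ᵇ_)
open import Data.Empty using (⊥-elim)
open import Data.Fin using (toℕ; fromℕ<; punchOut) renaming (zero to fzero)
open import Data.Fin.Properties
  using (any?; pigeonhole; injective⇒≤; punchOut-injective; toℕ-fromℕ<; toℕ<n)
  renaming (_≟_ to _≟ᶠ_)
open import Data.List using ([]; _∷_; length; filter; allFin)
open import Data.List.Membership.Propositional using (_∈_)
open import Data.List.Membership.Propositional.Properties using (∈-filter⁺; ∈-filter⁻; ∈-allFin)
open import Data.List.Relation.Unary.All using ([]; _∷_)
open import Data.List.Relation.Unary.AllPairs using (_∷_)
open import Data.List.Relation.Unary.Any using (here; there)
open import Data.List.Relation.Unary.Unique.Propositional using (Unique)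
open import Data.List.Relation.Unary.Unique.Propositional.Properties using (allFin⁺; filter⁺)
open import Data.Nat using (zero; suc; _+_; _*_; _%_; _/_; _<_; s≤s; s≤s⁻¹; z≤n)
open import Data.Nat.DivMod using (m≡m%n+[m/n]*n; m%n<n)
open import Data.Nat.GeneralisedArithmetic using (fold; fold-+)
open import Data.Nat.Properties
  using ( _≟_; suc-injective; +-comm; +-suc; n<1+n; m≤n+m; ≤-trans; ≤-antisym; ≮⇒≥
        ; m≤n⇒∃[o]m+o≡n; 1+n≰n)
open import Data.Product using (_,_; proj₁; proj₂; ∃)
open import Data.Sum using (_⊎_; inj₁; inj₂; [_,_]; swap) renaming (map to map-⊎)
open import Function.Base using (_∘_)
open import Function.Bundles using (mk⤖; _⇔_; mk⇔; Equivalence)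
open import Function.Consequences.Propositional using (strictlySurjective⇒surjective)
open import Function.Definitions using (Injective; StrictlySurjective)
open import Function.Properties.Bijection using (sym-≡)
open import Relation.Binary.PropositionalEquality
  using (_≢_; refl; sym; trans; cong; cong₂; subst; module ≡-Reasoning)
open import Relation.Nullary using (¬_; yes; no; Dec; contradiction)
open import Relation.Nullary.Decidable using (⌊_⌋)
open import Relation.Unary using (Decidable)

open ≡-Reasoning
open Equivalence using (to; from)

record ExactlyTwo {n : ℕ} (P : Fin n → Set) : Set where
  field
    fst snd : Fin n
    fst≢snd : fst ≢ snd
    P-fst : P fst
    P-snd : P snd
    only : ∀ x → P x → x ≡ fst ⊎ x ≡ snd

  one-of : ∀ {x y z} → P x → P y → x ≢ y → P z → z ≡ x ⊎ z ≡ y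
  one-of {x} {y} {z} Px Py x≢y Pz with only x Px | only y Py | only z Pz
  ... | inj₁ refl | inj₁ refl | _         = contradiction refl x≢y
  ... | inj₂ refl | inj₂ refl | _         = contradiction refl x≢y
  ... | inj₁ refl | _         | inj₁ refl = inj₁ refl
  ... | inj₂ refl | _         | inj₂ refl = inj₁ refl
  ... | _         | inj₁ refl | inj₁ refl = inj₂ refl
  ... | _         | inj₂ refl | inj₂ refl = inj₂ refl

count≡2⇒exactlyTwo : ∀ {n} {P : Fin n → Set} (P? : Decidable P) →
                     length (filter P? (allFin n)) ≡ 2 → ExactlyTwo P
count≡2⇒exactlyTwo {n} {P} P? count≡2 =
  fromList (filter⁺ P? (allFin⁺ n)) count≡2
    (proj₂ ∘ ∈-filter⁻ P? {xs = allFin n}) (∈-filter⁺ P? (∈-allFin _))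
  where
  fromList : ∀ {xs} → Unique xs → length xs ≡ 2 →
             (∀ {x} → x ∈ xs → P x) → (∀ {x} → P x → x ∈ xs) → ExactlyTwo P
  fromList {p ∷ q ∷ []} ((p≢q ∷ []) ∷ _) _ sound complete = record
    { fst = p ; snd = q ; fst≢snd = p≢q
    ; P-fst = sound (here refl) ; P-snd = sound (there (here refl))
    ; only = λ x → member ∘ complete }
    where
    member : ∀ {x} → x ∈ p ∷ q ∷ [] → x ≡ p ⊎ x ≡ q
    member (here x≡p)         = inj₁ x≡p
    member (there (here x≡q)) = inj₂ x≡q

injective⇒strictlySurjective : ∀ {n} {f : Fin n → Fin n} →
                               Injective _≡_ _≡_ f → StrictlySurjective _≡_ f
injective⇒strictlySurjective {suc k} {f} f-inj y with any? (λ x → f x ≟ᶠ y)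
... | yes hit = hit
... | no miss = contradiction (injective⇒≤ avoid-y-injective) 1+n≰n
  where
  y≢f : ∀ x → y ≢ f x
  y≢f x y≡fx = miss (x , sym y≡fx)
  avoid-y : Fin (suc k) → Fin k
  avoid-y x = punchOut (y≢f x)
  avoid-y-injective : Injective _≡_ _≡_ avoid-y
  avoid-y-injective {a} {b} = f-inj ∘ punchOut-injective (y≢f a) (y≢f b)

-- The section s of f is an injective endomap, hence onto, and s ∘ f ≡ id follows.
strictlySurjective⇒injective : ∀ {n} {f : Fin n → Fin n} →
                               StrictlySurjective _≡_ f → Injective _≡_ _≡_ f
strictlySurjective⇒injective {n} {f} f-surj {a} {b} fa≡fb = begin
  a         ≡⟨ s∘f a ⟨
  s (f a)   ≡⟨ cong s fa≡fb ⟩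
  s (f b)   ≡⟨ s∘f b ⟩
  b         ∎
  where
  s : Fin n → Fin n
  s = proj₁ ∘ f-surj
  f∘s : ∀ y → f (s y) ≡ y
  f∘s = proj₂ ∘ f-surj
  s-surj : StrictlySurjective _≡_ s
  s-surj = injective⇒strictlySurjective λ {x} {y} sx≡sy →
    trans (sym (f∘s x)) (trans (cong f sx≡sy) (f∘s y))
  s∘f : ∀ x → s (f x) ≡ x
  s∘f x with x′ , refl ← s-surj x = cong s (f∘s x′)

fold-injective : ∀ {A : Set} {σ : A → A} → Injective _≡_ _≡_ σ →
                 ∀ k {a b} → fold a σ k ≡ fold b σ k → a ≡ b
fold-injective σ-inj zero    eq = eq
fold-injective σ-inj (suc k) eq = fold-injective σ-inj k (σ-inj eq)

module Orbit {m : ℕ} (σ : Fin (suc m) → Fin (suc m)) (σ-injective : Injective _≡_ _≡_ σ)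
             (x : Fin (suc m)) where

  N : ℕ
  N = suc m

  orbit : ℕ → Fin N
  orbit k = fold x σ k

  orbit-+ : ∀ k d → orbit (k + d) ≡ fold (orbit k) σ d
  orbit-+ k d = trans (cong orbit (+-comm k d)) (fold-+ x σ d)

  collision⇒period : ∀ i q → orbit i ≡ orbit (i + suc q) → orbit (suc q) ≡ x
  collision⇒period i q orbitᵢ≡ = fold-injective σ-injective i (sym (begin
    orbit i                  ≡⟨ orbitᵢ≡ ⟩
    orbit (i + suc q)        ≡⟨ fold-+ x σ i ⟩
    fold (orbit (suc q)) σ i ∎))

  period : ∃ λ q → orbit (suc q) ≡ x × suc q ≤ N
  period
    with i , j , i<j , orbitᵢ≡orbitⱼ ← pigeonhole (n<1+n N) (λ (k : Fin (suc N)) → orbit (toℕ k))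
    with q , i+1+q≡j ← m≤n⇒∃[o]m+o≡n i<j
    = let j≡i+1+q : toℕ j ≡ toℕ i + suc q
          j≡i+1+q = trans (sym i+1+q≡j) (sym (+-suc (toℕ i) q))
      in q
    , collision⇒period (toℕ i) q (trans orbitᵢ≡orbitⱼ (cong orbit j≡i+1+q))
    , ≤-trans (m≤n+m (suc q) (toℕ i)) (subst (_≤ N) j≡i+1+q (s≤s⁻¹ (toℕ<n j)))

  q : ℕ
  q = proj₁ period

  orbit-period : orbit (suc q) ≡ x
  orbit-period = proj₁ (proj₂ period)

  orbit-*period : ∀ t → orbit (t * suc q) ≡ x
  orbit-*period zero    = refl
  orbit-*period (suc t) = begin
    orbit (suc q + t * suc q)           ≡⟨ fold-+ x σ (suc q) ⟩
    fold (orbit (t * suc q)) σ (suc q)  ≡⟨ cong (λ y → fold y σ (suc q)) (orbit-*period t) ⟩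
    orbit (suc q)                       ≡⟨ orbit-period ⟩
    x                                   ∎

  orbit-%period : ∀ k → orbit (k % suc q) ≡ orbit k
  orbit-%period k = begin
    orbit (k % suc q)
      ≡⟨ cong (λ y → fold y σ (k % suc q)) (orbit-*period (k / suc q)) ⟨
    fold (orbit (k / suc q * suc q)) σ (k % suc q)
      ≡⟨ fold-+ x σ (k % suc q) ⟨
    orbit (k % suc q + k / suc q * suc q)
      ≡⟨ cong orbit (m≡m%n+[m/n]*n k (suc q)) ⟨
    orbit k
      ∎

  InOrbit : Fin N → Set
  InOrbit y = ∃ λ k → orbit k ≡ y

  InOrbit-σ : ∀ {y} → InOrbit y → InOrbit (σ y)
  InOrbit-σ (k , refl) = suc k , refl

  InOrbit-σ⁻¹ : ∀ {y} → InOrbit (σ y) → InOrbit y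
  InOrbit-σ⁻¹ {y} (k , orbitₖ≡σy) = k + q , σ-injective (begin
    orbit (suc (k + q))      ≡⟨ cong orbit (+-suc k q) ⟨
    orbit (k + suc q)        ≡⟨ fold-+ x σ k ⟩
    fold (orbit (suc q)) σ k ≡⟨ cong (λ z → fold z σ k) orbit-period ⟩
    orbit k                  ≡⟨ orbitₖ≡σy ⟩
    σ y                      ∎)

  module Transitive (everywhere : ∀ y → InOrbit y) where

    cycle : Fin N → Fin N
    cycle i = orbit (toℕ i)

    cycle-surjective : StrictlySurjective _≡_ cycle
    cycle-surjective y with k , refl ← everywhere y =
      fromℕ< k%period<N , trans (cong orbit (toℕ-fromℕ< k%period<N)) (orbit-%period k)
      where
      k%period<N : k % suc q < N
      k%period<N = ≤-trans (m%n<n k (suc q)) (proj₂ (proj₂ period))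

    cycle-injective : Injective _≡_ _≡_ cycle
    cycle-injective = strictlySurjective⇒injective cycle-surjective

    period≡N : suc q ≡ N
    period≡N = ≤-antisym (proj₂ (proj₂ period)) (≮⇒≥ period≮N)
      where
      period≮N : ¬ suc q < N
      period≮N q<N = contradiction
        (trans (sym (toℕ-fromℕ< q<N)) (cong toℕ (cycle-injective {fromℕ< q<N} {fzero}
          (trans (cong orbit (toℕ-fromℕ< q<N)) orbit-period))))
        λ ()

    orbit-% : ∀ k → orbit (k % N) ≡ orbit k
    orbit-% = subst (λ r → ∀ k → orbit (k % suc r) ≡ orbit k) (suc-injective period≡N) orbit-%period

    orbit-N : orbit N ≡ x
    orbit-N = subst (λ p → orbit p ≡ x) period≡N orbit-period

    cycle-bijection : Fin N ⤖ Fin N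
    cycle-bijection = mk⤖ (cycle-injective , strictlySurjective⇒surjective cycle-surjective)

    position : Fin N ⤖ Fin N
    position = sym-≡ cycle-bijection

    cycle∘position : ∀ y → cycle (Bijection.to position y) ≡ y
    cycle∘position y = proj₂ (Bijection.surjective cycle-bijection y) refl

    cycle≡step⇔ : ∀ i j d → (cycle j ≡ fold (cycle i) σ d) ⇔ (toℕ j ≡ (toℕ i + d) % N)
    cycle≡step⇔ i j d = mk⇔ onCycle⇒index index⇒onCycle
      where
      k<N : (toℕ i + d) % N < N
      k<N = m%n<n (toℕ i + d) N
      onCycle⇒index : cycle j ≡ fold (cycle i) σ d → toℕ j ≡ (toℕ i + d) % N
      onCycle⇒index cycleⱼ≡ = trans (cong toℕ (cycle-injective (begin
        cycle j                 ≡⟨ cycleⱼ≡ ⟩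
        fold (cycle i) σ d      ≡⟨ orbit-+ (toℕ i) d ⟨
        orbit (toℕ i + d)       ≡⟨ orbit-% (toℕ i + d) ⟨
        orbit ((toℕ i + d) % N) ≡⟨ cong orbit (toℕ-fromℕ< k<N) ⟨
        cycle (fromℕ< k<N)      ∎))) (toℕ-fromℕ< k<N)
      index⇒onCycle : toℕ j ≡ (toℕ i + d) % N → cycle j ≡ fold (cycle i) σ d
      index⇒onCycle j≡ = begin
        cycle j                 ≡⟨ cong orbit j≡ ⟩
        orbit ((toℕ i + d) % N) ≡⟨ orbit-% (toℕ i + d) ⟩
        orbit (toℕ i + d)       ≡⟨ orbit-+ (toℕ i) d ⟩
        fold (cycle i) σ d      ∎

preserved-along : ∀ {n} {A : Digraph n} (P : Fin n → Set) →
                  (∀ {v w} → Adjacent A v w → P v → P w) →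
                  ∀ {u w} → P u → WeakReach A u w → P w
preserved-along P step-preserves Pu here             = Pu
preserved-along P step-preserves Pu (step reach adj) =
  step-preserves adj (preserved-along P step-preserves Pu reach)

≡⌊⌋∨⌊⌋ : ∀ {b : Bool} {P Q : Set} (P? : Dec P) (Q? : Dec Q) →
         (b ≡ true → P ⊎ Q) → (P ⊎ Q → b ≡ true) → b ≡ ⌊ P? ⌋ ∨ ⌊ Q? ⌋
≡⌊⌋∨⌊⌋ (yes p) _ _ from = from (inj₁ p)
≡⌊⌋∨⌊⌋ (no ¬p) (yes q) _ from = from (inj₂ q)
≡⌊⌋∨⌊⌋ {false} (no ¬p) (no ¬q) to _ = refl
≡⌊⌋∨⌊⌋ {true}  (no ¬p) (no ¬q) to _ = ⊥-elim ([ ¬p , ¬q ] (to refl))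

module Successor {n : ℕ} (A : Digraph n) (oriented : Oriented A) (p1 : P1 A) (p2 : P2 A) where

  infix 4 _⟶_
  _⟶_ : Fin n → Fin n → Set
  u ⟶ v = A u v ≡ true

  ¬loop : ∀ {u} → ¬ u ⟶ u
  ¬loop {u} u⟶u = contradiction (trans (sym (proj₁ oriented u)) u⟶u) λ ()

  ⟶⇒≢ : ∀ {u v} → u ⟶ v → u ≢ v
  ⟶⇒≢ u⟶u refl = ¬loop u⟶u

  ⟶-asym : ∀ {u v} → u ⟶ v → ¬ v ⟶ u
  ⟶-asym {u} {v} u⟶v v⟶u = contradiction (trans (sym (proj₂ oriented u v u⟶v)) v⟶u) λ ()

  outNeighbours : ∀ u → ExactlyTwo (u ⟶_)
  outNeighbours u = count≡2⇒exactlyTwo (λ v → A u v ≟ᵇ true) (proj₂ (p1 u))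

  record InNeighbours (v : Fin n) : Set where
    field
      top bottom : Fin n
      top⟶ : top ⟶ v
      bottom⟶ : bottom ⟶ v
      bottom⟶top : bottom ⟶ top
      only : ∀ u → u ⟶ v → u ≡ top ⊎ u ≡ bottom

  inNeighbourPair : ∀ v → ExactlyTwo (_⟶ v)
  inNeighbourPair v = count≡2⇒exactlyTwo (λ u → A u v ≟ᵇ true) (proj₁ (p1 v))

  orient : ∀ {v} (e : ExactlyTwo (_⟶ v)) → Adjacent A (ExactlyTwo.fst e) (ExactlyTwo.snd e) →
           InNeighbours v
  orient e (inj₁ fst⟶snd) = record
    { top = snd ; bottom = fst ; top⟶ = P-snd ; bottom⟶ = P-fst ; bottom⟶top = fst⟶snd
    ; only = λ u → swap ∘ only u }
    where open ExactlyTwo e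
  orient e (inj₂ snd⟶fst) = record
    { top = fst ; bottom = snd ; top⟶ = P-fst ; bottom⟶ = P-snd ; bottom⟶top = snd⟶fst
    ; only = only }
    where open ExactlyTwo e

  -- abstract, here and for succ, only so that top and succ are never unfolded to their
  -- witnesses (a search through filter … (allFin n)), which makes type checking very slow.
  abstract
    inNeighbours : ∀ v → InNeighbours v
    inNeighbours v = orient (inNeighbourPair v) (p2 v fst snd P-fst P-snd fst≢snd)
      where open ExactlyTwo (inNeighbourPair v)

  module In v = InNeighbours (inNeighbours v)
  open In using (top; bottom; top⟶; bottom⟶; bottom⟶top)

  out-of-bottom : ∀ v {w} → bottom v ⟶ w → w ≡ top v ⊎ w ≡ v
  out-of-bottom v = ExactlyTwo.one-of (outNeighbours (bottom v))
    (bottom⟶top v) (bottom⟶ v) (⟶⇒≢ (top⟶ v))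

  top∘top : ∀ v → top (top v) ≡ bottom v
  top∘top v with In.only (top v) (bottom v) (bottom⟶top v)
  ... | inj₁ b≡tt = sym b≡tt
  ... | inj₂ b≡bt with out-of-bottom v (subst (_⟶ top (top v)) (sym b≡bt) (bottom⟶top (top v)))
  ...   | inj₁ tt≡t = contradiction tt≡t (⟶⇒≢ (top⟶ (top v)))
  ...   | inj₂ tt≡v = contradiction (subst (_⟶ top v) tt≡v (top⟶ (top v))) (⟶-asym (top⟶ v))

  bottom-injective : Injective _≡_ _≡_ bottom
  bottom-injective {v} {w} bv≡bw
    with out-of-bottom v (subst (_⟶ w) (sym bv≡bw) (bottom⟶ w))
       | out-of-bottom w (subst (_⟶ v) bv≡bw (bottom⟶ v))
  ... | inj₂ w≡v  | _         = sym w≡v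
  ... | inj₁ _    | inj₂ v≡w  = v≡w
  ... | inj₁ w≡tv | inj₁ v≡tw = contradiction (subst (_⟶ w) (sym v≡tw) (top⟶ w))
                                 (⟶-asym (subst (_⟶ v) (sym w≡tv) (top⟶ v)))

  top-injective : Injective _≡_ _≡_ top
  top-injective {v} {w} tv≡tw = bottom-injective (begin
    bottom v        ≡⟨ top∘top v ⟨
    top (top v)     ≡⟨ cong top tv≡tw ⟩
    top (top w)     ≡⟨ top∘top w ⟩
    bottom w        ∎)

  abstract
    succ : Fin n → Fin n
    succ = proj₁ ∘ injective⇒strictlySurjective top-injective

    top∘succ : ∀ u → top (succ u) ≡ u
    top∘succ = proj₂ ∘ injective⇒strictlySurjective top-injective

  succ∘top : ∀ v → succ (top v) ≡ v
  succ∘top v = top-injective (top∘succ (top v))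

  succ-injective : Injective _≡_ _≡_ succ
  succ-injective {u} {w} su≡sw = trans (sym (top∘succ u)) (trans (cong top su≡sw) (top∘succ w))

  ⟶succ : ∀ u → u ⟶ succ u
  ⟶succ u = subst (_⟶ succ u) (top∘succ u) (top⟶ (succ u))

  ⟶succ² : ∀ u → u ⟶ succ (succ u)
  ⟶succ² u = subst (_⟶ succ (succ u)) bottom≡u (bottom⟶ (succ (succ u)))
    where
    bottom≡u : bottom (succ (succ u)) ≡ u
    bottom≡u = begin
      bottom (succ (succ u))       ≡⟨ top∘top _ ⟨
      top (top (succ (succ u)))    ≡⟨ cong top (top∘succ (succ u)) ⟩
      top (succ u)                 ≡⟨ top∘succ u ⟩
      u                            ∎

  ⟶⇒succ : ∀ {u v} → u ⟶ v → v ≡ succ u ⊎ v ≡ succ (succ u)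
  ⟶⇒succ {u} {v} u⟶v with In.only v u u⟶v
  ... | inj₁ refl = inj₁ (sym (succ∘top v))
  ... | inj₂ refl = inj₂ (begin
    v                            ≡⟨ succ∘top v ⟨
    succ (top v)                 ≡⟨ cong succ (succ∘top (top v)) ⟨
    succ (succ (top (top v)))    ≡⟨ cong (succ ∘ succ) (top∘top v) ⟩
    succ (succ (bottom v))       ∎)

  ⟶⇔succ : ∀ u v → u ⟶ v ⇔ (v ≡ succ u ⊎ v ≡ succ (succ u))
  ⟶⇔succ u v = mk⇔ ⟶⇒succ [ (λ { refl → ⟶succ u }) , (λ { refl → ⟶succ² u }) ]

  return-time≥5 : ∀ {u} k → fold u succ (suc k) ≡ u → 5 ≤ suc k
  return-time≥5 {u} 0 eq = contradiction (subst (u ⟶_) eq (⟶succ u)) ¬loop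
  return-time≥5 {u} 1 eq = contradiction (subst (u ⟶_) eq (⟶succ² u)) ¬loop
  return-time≥5 {u} 2 eq =
    contradiction (subst (succ (succ u) ⟶_) eq (⟶succ (succ (succ u)))) (⟶-asym (⟶succ² u))
  return-time≥5 {u} 3 eq =
    contradiction (subst (succ (succ u) ⟶_) eq (⟶succ² (succ (succ u)))) (⟶-asym (⟶succ² u))
  return-time≥5 (suc (suc (suc (suc k)))) _ = s≤s (s≤s (s≤s (s≤s (s≤s z≤n))))

module Connected {m : ℕ} (A : Digraph (suc m)) (oriented : Oriented A) (p1 : P1 A) (p2 : P2 A)
                 (reach : ∀ u v → WeakReach A u v) where

  open Successor A oriented p1 p2 public
  open Orbit succ succ-injective fzero public

  everywhere : ∀ v → InOrbit v
  everywhere v = preserved-along InOrbit adjacent-preserves (0 , refl) (reach fzero v)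
    where
    adjacent-preserves : ∀ {v w} → Adjacent A v w → InOrbit v → InOrbit w
    adjacent-preserves (inj₁ v⟶w) with ⟶⇒succ v⟶w
    ... | inj₁ refl = InOrbit-σ
    ... | inj₂ refl = InOrbit-σ ∘ InOrbit-σ
    adjacent-preserves (inj₂ w⟶v) with ⟶⇒succ w⟶v
    ... | inj₁ refl = InOrbit-σ⁻¹
    ... | inj₂ refl = InOrbit-σ⁻¹ ∘ InOrbit-σ⁻¹

  open Transitive everywhere public

  A∘cycle≡F : ∀ i j → A (cycle i) (cycle j) ≡ F N i j
  A∘cycle≡F i j = ≡⌊⌋∨⌊⌋ (toℕ j ≟ (toℕ i + 1) % N) (toℕ j ≟ (toℕ i + 2) % N)
    (map-⊎ (to (cycle≡step⇔ i j 1)) (to (cycle≡step⇔ i j 2)) ∘ to (⟶⇔succ _ _))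
    (from (⟶⇔succ _ _) ∘ map-⊎ (from (cycle≡step⇔ i j 1)) (from (cycle≡step⇔ i j 2)))

  A≡F∘position : ∀ u v → A u v ≡ F N (Bijection.to position u) (Bijection.to position v)
  A≡F∘position u v = begin
    A u v                  ≡⟨ cong₂ A (cycle∘position u) (cycle∘position v) ⟨
    A (cycle i) (cycle j)  ≡⟨ A∘cycle≡F i j ⟩
    F N i j                ∎
    where
    i j : Fin N
    i = Bijection.to position u
    j = Bijection.to position v

mainTheorem8 : (n : ℕ) (A : Digraph n) → Oriented A → WeaklyConnected A → P1 A → P2 A →
    (5 ≤ n) × Σ (Fin n ⤖ Fin n) (λ f → (u v : Fin n) → A u v ≡ F n (Bijection.to f u) (Bijection.to f v))
mainTheorem8 .(suc m) A oriented (nonEmpty m , reach) p1 p2 =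
  return-time≥5 m orbit-N , position , A≡F∘position
  where open Connected A oriented p1 p2 reach
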